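{- Let $G=(V,E)$ be a finite directed graph. Then the set $\mathrm{pas}_{\mathrm{min}}(G)$ of all non-empty minimal passages of $G$ is a passage partitioning of $G$.
   Context: A directed graph is a pair $G=(V,E)$ with $E\subseteq V\times V$; finite means $V$ is finite. A set $P\subseteq E$ is a passage of $G$ if for every $(x,y)\in P$ and all $x',y'\in V$ with $(x,y')\in E$ and $(x',y)\in E$, we have $(x,y')\in P$ and $(x',y)\in P$. A passage $P$ is minimal if there is no non-empty passage $P'$ of $G$ with $P'\subsetneq P$. A passage partitioning of $G$ is a finite set $\mathcal P=\{P_1,\dots,P_n\}$ of non-empty passages of $G$ such that $\bigcup_{i=1}^n P_i=E$ and $P_i\cap P_j=\emptyset$ for all $1\le i<j\le n$. -}

module Defs where

open import Data.Nat using (ℕ)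
open import Data.Fin using (Fin)
open import Data.Bool using (Bool; true)
open import Data.Product using (_×_; ∃; ∃-syntax; Σ-syntax)
open import Relation.Binary.PropositionalEquality using (_≡_)
open import Relation.Nullary using (¬_)
open import Function.Bundles using (_⇔_)

-- A finite directed graph on vertex set V = Fin n is given by its edge set
-- E ⊆ V × V, represented as a (decidable) characteristic function.
Graph : ℕ → Set
Graph n = Fin n → Fin n → Bool

EdgeSet : ℕ → Set
EdgeSet n = Fin n → Fin n → Bool

module _ {n : ℕ} where

  _,_∈ₑ_ : Fin n → Fin n → EdgeSet n → Set
  x , y ∈ₑ P = P x y ≡ true

  _⊆ₑ_ : EdgeSet n → EdgeSet n → Set
  P ⊆ₑ Q = ∀ x y → x , y ∈ₑ P → x , y ∈ₑ Q

  _⊊ₑ_ : EdgeSet n → EdgeSet n → Set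
  P ⊊ₑ Q = (P ⊆ₑ Q) × ¬ (Q ⊆ₑ P)

  _≐ₑ_ : EdgeSet n → EdgeSet n → Set
  P ≐ₑ Q = (P ⊆ₑ Q) × (Q ⊆ₑ P)

  NonEmpty : EdgeSet n → Set
  NonEmpty P = ∃[ x ] ∃[ y ] (x , y ∈ₑ P)

  IsPassage : Graph n → EdgeSet n → Set
  IsPassage E P =
    (P ⊆ₑ E) ×
    (∀ x y → x , y ∈ₑ P →
       (∀ y′ → x , y′ ∈ₑ E → x , y′ ∈ₑ P) ×
       (∀ x′ → x′ , y ∈ₑ E → x′ , y ∈ₑ P))

  IsMinimalPassage : Graph n → EdgeSet n → Set
  IsMinimalPassage E P =
    IsPassage E P ×
    ¬ (Σ[ P′ ∈ EdgeSet n ] (IsPassage E P′ × NonEmpty P′ × P′ ⊊ₑ P))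

  InPasMin : Graph n → EdgeSet n → Set
  InPasMin E P = NonEmpty P × IsMinimalPassage E P

  -- A finite family {P_i | i : Fin m} is a passage partitioning of G:
  -- non-empty passages, covering E, pairwise disjoint for distinct indices
  -- (so in particular the P_i are pairwise distinct).
  IsPassagePartitioning : Graph n → {m : ℕ} → (Fin m → EdgeSet n) → Set
  IsPassagePartitioning E {m} 𝒫 =
    (∀ i → IsPassage E (𝒫 i) × NonEmpty (𝒫 i)) ×
    (∀ x y → x , y ∈ₑ E → ∃[ i ] (x , y ∈ₑ 𝒫 i)) ×
    (∀ i j → ¬ (i ≡ j) → ∀ x y → ¬ ((x , y ∈ₑ 𝒫 i) × (x , y ∈ₑ 𝒫 j)))

  Enumerates : Graph n → {m : ℕ} → (Fin m → EdgeSet n) → Set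
  Enumerates E {m} 𝒫 =
    ∀ (P : EdgeSet n) → InPasMin E P ⇔ (∃[ i ] (𝒫 i ≐ₑ P))

module Submission where

-- Call two vertices x, x′ of G = (Fin n, E) *linked* if they are related by
-- the equivalence relation generated by "x and x′ have a common
-- out-neighbour".  A passage containing some edge leaving x contains every
-- edge leaving every vertex linked to x; conversely, the edges leaving the
-- linked class of x form a passage, the *component* of x.  Hence the
-- non-empty minimal passages are exactly the components of vertices having
-- an out-edge, and two components are disjoint or equal.

open import Defs
open import Data.Nat using (ℕ; zero; suc; s<s)
open import Data.Fin using (Fin; zero; suc; _<_)
open import Data.Fin.Properties using (all?; _<?_; <-cmp)
open import Data.Bool using (Bool; true; false; _∧_; _∨_; _≟_)
open import Data.Bool.Properties using (∧-conicalˡ; ∧-conicalʳ; ∧-comm)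
open import Data.Product using (_×_; Σ-syntax; _,_; proj₁; proj₂; ∃-syntax)
open import Data.Sum using (_⊎_; inj₁; inj₂)
open import Data.Empty using (⊥-elim)
open import Data.List using (List; filter; allFin; length; lookup)
open import Data.List.Relation.Unary.All as All using ()
open import Data.List.Relation.Unary.Any using (index)
open import Data.List.Relation.Unary.Any.Properties using (lookup-index)
open import Data.List.Relation.Unary.AllPairs using (_∷_)
open import Data.List.Relation.Unary.Unique.Propositional using (Unique)
open import Data.List.Relation.Unary.Unique.Propositional.Properties using (allFin⁺; filter⁺)
open import Data.List.Membership.Propositional using (_∈_)
open import Data.List.Membership.Propositional.Properties using (∈-filter⁺; ∈-filter⁻; ∈-lookup; ∈-allFin)
open import Function using (_∘_)
open import Function.Bundles using (mk⇔)
open import Relation.Nullary using (¬_; yes; no)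
open import Relation.Nullary.Decidable using (decidable-stable; _×-dec_; _→-dec_; ¬?)
open import Relation.Unary using (Pred; Decidable)
open import Relation.Binary.PropositionalEquality using (_≡_; refl; sym; trans; cong)
open import Relation.Binary.Definitions using (tri<; tri≈; tri>)

∧-intro : ∀ {a b} → a ≡ true → b ≡ true → a ∧ b ≡ true
∧-intro refl refl = refl

∧-elimˡ : ∀ {a b} → a ∧ b ≡ true → a ≡ true
∧-elimˡ = ∧-conicalˡ _ _

∧-elimʳ : ∀ {a b} → a ∧ b ≡ true → b ≡ true
∧-elimʳ = ∧-conicalʳ _ _

∨-introˡ : ∀ {a b} → a ≡ true → a ∨ b ≡ true
∨-introˡ refl = refl

∨-introʳ : ∀ {a b} → b ≡ true → a ∨ b ≡ true
∨-introʳ {true}  _ = refl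
∨-introʳ {false} p = p

∨-elim : ∀ {a b} → a ∨ b ≡ true → a ≡ true ⊎ b ≡ true
∨-elim {true}  _ = inj₁ refl
∨-elim {false} p = inj₂ p

exists : ∀ {n} → (Fin n → Bool) → Bool
exists {zero}  f = false
exists {suc n} f = f zero ∨ exists (f ∘ suc)

exists-intro : ∀ {n} {f : Fin n → Bool} i → f i ≡ true → exists f ≡ true
exists-intro zero    p = ∨-introˡ p
exists-intro (suc i) p = ∨-introʳ (exists-intro i p)

exists-elim : ∀ {n} {f : Fin n → Bool} → exists f ≡ true → ∃[ i ] f i ≡ true
exists-elim {suc n} p with ∨-elim p
... | inj₁ p₀ = zero , p₀
... | inj₂ pₛ with exists-elim pₛ
...   | i , pᵢ = suc i , pᵢ

least-witness : ∀ {n p} (P : Pred (Fin n) p) → Decidable P → ∀ {x} → P x →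
                ∃[ r ] (P r × (∀ r′ → r′ < r → ¬ P r′))
least-witness {suc n} P P? {x} px with P? zero
... | yes p₀ = zero , p₀ , λ _ ()
least-witness {suc n} P P? {zero}  px | no ¬p₀ = ⊥-elim (¬p₀ px)
least-witness {suc n} P P? {suc x} px | no ¬p₀
  with least-witness (P ∘ suc) (P? ∘ suc) px
... | r , pr , below = suc r , pr , λ { zero _ → ¬p₀ ; (suc r′) (s<s r′<r) → below r′ r′<r }

lookup-injective : ∀ {a} {A : Set a} {xs : List A} → Unique xs →
                   ∀ i j → lookup xs i ≡ lookup xs j → i ≡ j
lookup-injective (_   ∷ _) zero    zero    _  = refl
lookup-injective (x∉ ∷ _) zero    (suc j) eq = ⊥-elim (All.lookup x∉ (∈-lookup j) eq)
lookup-injective (x∉ ∷ _) (suc i) zero    eq = ⊥-elim (All.lookup x∉ (∈-lookup i) (sym eq))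
lookup-injective (_   ∷ u) (suc i) (suc j) eq = cong suc (lookup-injective u i j eq)

-- Since membership in an edge set is decidable, inclusion is stable under
-- double negation.
⊆ₑ-stable : ∀ {n} {P Q : EdgeSet n} → ¬ ¬ (P ⊆ₑ Q) → P ⊆ₑ Q
⊆ₑ-stable {Q = Q} ¬¬P⊆Q x y p =
  decidable-stable (Q x y ≟ true) λ ¬q → ¬¬P⊆Q λ P⊆Q → ¬q (P⊆Q x y p)

BoolRel : ℕ → Set
BoolRel n = Fin n → Fin n → Bool

Symmetric : ∀ {n} → BoolRel n → Set
Symmetric A = ∀ u v → A u v ≡ true → A v u ≡ true

Closed : ∀ {n} → BoolRel n → (Fin n → Set) → Set
Closed A Q = ∀ {u v} → A u v ≡ true → Q u → Q v

bypass0 : ∀ {n} → BoolRel (suc n) → BoolRel n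
bypass0 A u v = A (suc u) (suc v) ∨ (A (suc u) zero ∧ A zero (suc v))

-- The equivalence closure of a symmetric relation A.  Vertex 0 is linked to
-- v ≠ 0 iff v is linked, avoiding 0, to a neighbour of 0 ('joinsZero'); two
-- vertices other than 0 are linked iff they are linked by bypass0 A.
mutual
  closure : ∀ {n} → BoolRel n → BoolRel n
  closure {suc n} A zero    zero    = true
  closure {suc n} A zero    (suc v) = joinsZero A v
  closure {suc n} A (suc u) zero    = joinsZero A u
  closure {suc n} A (suc u) (suc v) = closure (bypass0 A) u v

  joinsZero : ∀ {n} → BoolRel (suc n) → Fin n → Bool
  joinsZero A v = exists λ w → A zero (suc w) ∧ closure (bypass0 A) w v

bypass0-sym : ∀ {n} (A : BoolRel (suc n)) → Symmetric A → Symmetric (bypass0 A)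
bypass0-sym A sym-A u v e with ∨-elim e
... | inj₁ uv = ∨-introˡ (sym-A _ _ uv)
... | inj₂ u0v = ∨-introʳ (∧-intro (sym-A _ _ (∧-elimʳ u0v)) (sym-A _ _ (∧-elimˡ u0v)))

bypass0-closed : ∀ {n} (A : BoolRel (suc n)) (Q : Fin (suc n) → Set) →
                 Closed A Q → Closed (bypass0 A) (Q ∘ suc)
bypass0-closed A Q closed e q with ∨-elim e
... | inj₁ uv  = closed uv q
... | inj₂ u0v = closed (∧-elimʳ u0v) (closed (∧-elimˡ u0v) q)

closure-refl : ∀ {n} (A : BoolRel n) u → closure A u u ≡ true
closure-refl {suc n} A zero    = refl
closure-refl {suc n} A (suc u) = closure-refl (bypass0 A) u

closure-sym : ∀ {n} (A : BoolRel n) → Symmetric A → Symmetric (closure A)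
closure-sym {suc n} A sym-A zero    zero    p = p
closure-sym {suc n} A sym-A zero    (suc v) p = p
closure-sym {suc n} A sym-A (suc u) zero    p = p
closure-sym {suc n} A sym-A (suc u) (suc v) p =
  closure-sym (bypass0 A) (bypass0-sym A sym-A) u v p

closure-⊇ : ∀ {n} (A : BoolRel n) → Symmetric A →
            ∀ u v → A u v ≡ true → closure A u v ≡ true
closure-⊇ {suc n} A sym-A zero    zero    _ = refl
closure-⊇ {suc n} A sym-A zero    (suc v) e =
  exists-intro v (∧-intro e (closure-refl (bypass0 A) v))
closure-⊇ {suc n} A sym-A (suc u) zero    e =
  exists-intro u (∧-intro (sym-A _ _ e) (closure-refl (bypass0 A) u))
closure-⊇ {suc n} A sym-A (suc u) (suc v) e =
  closure-⊇ (bypass0 A) (bypass0-sym A sym-A) u v (∨-introˡ e)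

mutual
  closure-trans : ∀ {n} (A : BoolRel n) → Symmetric A → ∀ u v w →
                  closure A u v ≡ true → closure A v w ≡ true → closure A u w ≡ true
  closure-trans {suc n} A sym-A zero    zero    w       _ q = q
  closure-trans {suc n} A sym-A zero    (suc v) zero    _ _ = refl
  closure-trans {suc n} A sym-A zero    (suc v) (suc w) p q = joinsZero-step A sym-A v w q p
  closure-trans {suc n} A sym-A (suc u) zero    zero    p _ = p
  closure-trans {suc n} A sym-A (suc u) zero    (suc w) p q = joinsZero-joint A sym-A u w p q
  closure-trans {suc n} A sym-A (suc u) (suc v) zero    p q =
    joinsZero-step A sym-A v u (closure-sym (bypass0 A) (bypass0-sym A sym-A) u v p) q
  closure-trans {suc n} A sym-A (suc u) (suc v) (suc w) p q =
    closure-trans (bypass0 A) (bypass0-sym A sym-A) u v w p q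

  joinsZero-step : ∀ {n} (A : BoolRel (suc n)) → Symmetric A → ∀ v w →
                   closure (bypass0 A) v w ≡ true → joinsZero A v ≡ true → joinsZero A w ≡ true
  joinsZero-step A sym-A v w vw j with exists-elim j
  ... | a , h = exists-intro a (∧-intro (∧-elimˡ h)
                  (closure-trans (bypass0 A) (bypass0-sym A sym-A) a v w (∧-elimʳ h) vw))

  -- Two vertices that both join 0 are linked to each other avoiding 0,
  -- because any two neighbours of 0 are bypass0 A-related.
  joinsZero-joint : ∀ {n} (A : BoolRel (suc n)) → Symmetric A → ∀ u w →
                    joinsZero A u ≡ true → joinsZero A w ≡ true → closure (bypass0 A) u w ≡ true
  joinsZero-joint A sym-A u w ju jw with exists-elim ju | exists-elim jw
  ... | a , ha | b , hb =
    closure-trans A′ sym-A′ u a w (closure-sym A′ sym-A′ a u (∧-elimʳ ha))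
      (closure-trans A′ sym-A′ a b w a~b (∧-elimʳ hb))
    where
    A′ : BoolRel _
    A′ = bypass0 A
    sym-A′ : Symmetric A′
    sym-A′ = bypass0-sym A sym-A
    a~b : closure A′ a b ≡ true
    a~b = closure-⊇ A′ sym-A′ a b (∨-introʳ (∧-intro (sym-A _ _ (∧-elimˡ ha)) (∧-elimˡ hb)))

closure-closed : ∀ {n} (A : BoolRel n) → Symmetric A → (Q : Fin n → Set) →
                 Closed A Q → Closed (closure A) Q
closure-closed {suc n} A sym-A Q closed {zero}  {zero}  _ q = q
closure-closed {suc n} A sym-A Q closed {zero}  {suc v} p q with exists-elim p
... | a , h = closure-closed (bypass0 A) (bypass0-sym A sym-A) (Q ∘ suc)
                (bypass0-closed A Q closed) {a} (∧-elimʳ h) (closed (∧-elimˡ h) q)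
closure-closed {suc n} A sym-A Q closed {suc u} {zero}  p q with exists-elim p
... | a , h = closed (sym-A _ _ (∧-elimˡ h))
                (closure-closed (bypass0 A) (bypass0-sym A sym-A) (Q ∘ suc)
                  (bypass0-closed A Q closed) {u}
                  (closure-sym (bypass0 A) (bypass0-sym A sym-A) a u (∧-elimʳ h)) q)
closure-closed {suc n} A sym-A Q closed {suc u} {suc v} p q =
  closure-closed (bypass0 A) (bypass0-sym A sym-A) (Q ∘ suc) (bypass0-closed A Q closed) p q

InPasMin-resp-≐ : ∀ {n} (E : Graph n) {P Q : EdgeSet n} → P ≐ₑ Q → InPasMin E P → InPasMin E Q
InPasMin-resp-≐ E {P} {Q} (P⊆Q , Q⊆P) ((x , y , pxy) , (P⊆E , P-closed) , P-minimal) =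
  (x , y , P⊆Q x y pxy) , (Q⊆E , Q-closed) , Q-minimal
  where
  Q⊆E : Q ⊆ₑ E
  Q⊆E a b q = P⊆E a b (Q⊆P a b q)
  Q-closed : ∀ a b → a , b ∈ₑ Q →
             (∀ b′ → a , b′ ∈ₑ E → a , b′ ∈ₑ Q) × (∀ a′ → a′ , b ∈ₑ E → a′ , b ∈ₑ Q)
  Q-closed a b q = (λ b′ e → P⊆Q a b′ (proj₁ (P-closed a b (Q⊆P a b q)) b′ e))
                 , (λ a′ e → P⊆Q a′ b (proj₂ (P-closed a b (Q⊆P a b q)) a′ e))
  Q-minimal : ¬ (Σ[ P′ ∈ EdgeSet _ ] (IsPassage E P′ × NonEmpty P′ × P′ ⊊ₑ Q))
  Q-minimal (P′ , passage , nonEmpty , P′⊆Q , Q⊈P′) =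
    P-minimal (P′ , passage , nonEmpty , (λ a b p → Q⊆P a b (P′⊆Q a b p))
              , λ P⊆P′ → Q⊈P′ λ a b q → P⊆P′ a b (Q⊆P a b q))

module Components {n : ℕ} (E : Graph n) where

  hasOut : Fin n → Bool
  hasOut x = exists (E x)

  shareTarget : BoolRel n
  shareTarget x x′ = exists λ y → E x y ∧ E x′ y

  shareTarget-sym : Symmetric shareTarget
  shareTarget-sym x x′ p with exists-elim p
  ... | y , h = exists-intro y (trans (∧-comm (E x′ y) (E x y)) h)

  linked : BoolRel n
  linked = closure shareTarget

  linked-refl : ∀ x → linked x x ≡ true
  linked-refl = closure-refl shareTarget

  linked-sym : Symmetric linked
  linked-sym = closure-sym shareTarget shareTarget-sym

  linked-trans : ∀ x y z → linked x y ≡ true → linked y z ≡ true → linked x z ≡ true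
  linked-trans = closure-trans shareTarget shareTarget-sym

  component : Fin n → EdgeSet n
  component c x y = E x y ∧ linked c x

  -- A passage containing an edge leaving x contains every edge leaving any
  -- vertex linked to x: "contains all edges leaving u" is preserved by
  -- shareTarget, by closing first under the common target, then under the
  -- new source.
  passage-spreads : ∀ {P} → IsPassage E P → ∀ {x y} → x , y ∈ₑ P →
                    ∀ z w → linked x z ≡ true → z , w ∈ₑ E → z , w ∈ₑ P
  passage-spreads {P} (_ , P-closed) {x} {y} pxy z w x~z ezw =
    closure-closed shareTarget shareTarget-sym LeavesIn leavesIn-step x~z (proj₁ (P-closed x y pxy)) w ezw
    where
    LeavesIn : Fin n → Set
    LeavesIn u = ∀ w → u , w ∈ₑ E → u , w ∈ₑ P
    leavesIn-step : Closed shareTarget LeavesIn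
    leavesIn-step {u} {v} share leaves-u with exists-elim share
    ... | t , h = proj₁ (P-closed v t (proj₂ (P-closed u t (leaves-u t (∧-elimˡ h))) v (∧-elimʳ h)))

  component-least : ∀ {P} → IsPassage E P → ∀ {x y} → x , y ∈ₑ P → component x ⊆ₑ P
  component-least passage pxy a b q = passage-spreads passage pxy a b (∧-elimʳ q) (∧-elimˡ q)

  -- Components are passages: their rows are full by definition, and an edge
  -- (x′ , y) entering the column of (x , y) has x′ sharing the target y
  -- with x, which is linked to c.
  component-passage : ∀ c → IsPassage E (component c)
  component-passage c = (λ x y p → ∧-elimˡ p) , λ x y p →
    (λ y′ e → ∧-intro e (∧-elimʳ p)) ,
    (λ x′ e → ∧-intro e (linked-trans c x x′ (∧-elimʳ p)
                (closure-⊇ shareTarget shareTarget-sym x x′ (exists-intro y (∧-intro (∧-elimˡ p) e)))))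

  component-nonEmpty : ∀ c → hasOut c ≡ true → NonEmpty (component c)
  component-nonEmpty c out with exists-elim out
  ... | y , e = c , y , ∧-intro e (linked-refl c)

  component-⊆ : ∀ c x → linked c x ≡ true → component c ⊆ₑ component x
  component-⊆ c x c~x a b q =
    ∧-intro (∧-elimˡ q) (linked-trans x c a (linked-sym c x c~x) (∧-elimʳ q))

  component-≐ : ∀ c x → linked c x ≡ true → component c ≐ₑ component x
  component-≐ c x c~x = component-⊆ c x c~x , component-⊆ x c (linked-sym c x c~x)

  -- A non-empty passage inside component c contains an edge (x , y) with x
  -- linked to c, hence the whole component of x, which is that of c.
  component-minimal : ∀ c → IsMinimalPassage E (component c)
  component-minimal c = component-passage c ,
    λ { (P′ , passage , (x , y , pxy) , P′⊆C , C⊈P′) →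
        C⊈P′ λ a b q → component-least passage pxy a b
                         (component-⊆ c x (∧-elimʳ (P′⊆C x y pxy)) a b q) }

  -- A non-empty minimal passage through (x , y) contains the component of x,
  -- which is a non-empty passage, so by minimality it equals it.
  minimal-is-component : ∀ {P} → InPasMin E P → ∀ {x y} → x , y ∈ₑ P → P ≐ₑ component x
  minimal-is-component {P} (_ , passage , P-minimal) {x} {y} pxy =
    ⊆ₑ-stable (λ P⊈C → P-minimal (component x , component-passage x , C-nonEmpty , C⊆P , P⊈C)) , C⊆P
    where
    C⊆P : component x ⊆ₑ P
    C⊆P = component-least passage pxy
    C-nonEmpty : NonEmpty (component x)
    C-nonEmpty = x , y , ∧-intro (proj₁ passage x y pxy) (linked-refl x)

  IsLeader : Fin n → Set
  IsLeader r = hasOut r ≡ true × (∀ r′ → r′ < r → ¬ (hasOut r′ ≡ true × linked r′ r ≡ true))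

  isLeader? : Decidable IsLeader
  isLeader? r = (hasOut r ≟ true) ×-dec
    all? λ r′ → (r′ <? r) →-dec ¬? ((hasOut r′ ≟ true) ×-dec (linked r′ r ≟ true))

  leader-unique : ∀ r r′ → IsLeader r → IsLeader r′ → linked r r′ ≡ true → r ≡ r′
  leader-unique r r′ (out , least) (out′ , least′) r~r′ with <-cmp r r′
  ... | tri< r<r′ _ _ = ⊥-elim (least′ r r<r′ (out , r~r′))
  ... | tri≈ _ r≡r′ _ = r≡r′
  ... | tri> _ _ r′<r = ⊥-elim (least r′ r′<r (out′ , linked-sym r r′ r~r′))

  leader-exists : ∀ x → hasOut x ≡ true → ∃[ r ] (IsLeader r × linked r x ≡ true)
  leader-exists x out with least-witness (λ r → hasOut r ≡ true × linked r x ≡ true)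
                             (λ r → (hasOut r ≟ true) ×-dec (linked r x ≟ true))
                             (out , linked-refl x)
  ... | r , (out-r , r~x) , below =
    r , (out-r , λ r′ r′<r (out′ , r′~r) → below r′ r′<r (out′ , linked-trans r′ r x r′~r r~x)) , r~x

  leaders : List (Fin n)
  leaders = filter isLeader? (allFin n)

  leader-at : ∀ i → IsLeader (lookup leaders i)
  leader-at i = proj₂ (∈-filter⁻ isLeader? {xs = allFin n} (∈-lookup i))

  position-of : ∀ r → IsLeader r → ∃[ i ] (lookup leaders i ≡ r)
  position-of r leader = index r∈leaders , sym (lookup-index r∈leaders)
    where
    r∈leaders : r ∈ leaders
    r∈leaders = ∈-filter⁺ isLeader? (∈-allFin r) leader

  components : Fin (length leaders) → EdgeSet n
  components i = component (lookup leaders i)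

  edge-position : ∀ x y → x , y ∈ₑ E → ∃[ i ] (linked (lookup leaders i) x ≡ true)
  edge-position x y e with leader-exists x (exists-intro y e)
  ... | r , leader , r~x with position-of r leader
  ...   | i , refl = i , r~x

  -- A non-empty minimal passage is the component of the source of any of
  -- its edges, i.e. of that source's leader; conversely every listed
  -- component is a non-empty minimal passage.
  enumerates : Enumerates E components
  enumerates P = mk⇔ to from
    where
    to : InPasMin E P → ∃[ i ] (components i ≐ₑ P)
    to min@((x , y , pxy) , (P⊆E , _) , _) with edge-position x y (P⊆E x y pxy)
    ... | i , r~x with component-≐ _ x r~x | minimal-is-component min pxy
    ...   | C⊆ , C⊇ | P⊆ , P⊇ = i , (λ a b q → P⊇ a b (C⊆ a b q)) , (λ a b p → C⊇ a b (P⊆ a b p))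
    from : ∃[ i ] (components i ≐ₑ P) → InPasMin E P
    from (i , C≐P) = InPasMin-resp-≐ E C≐P
      (component-nonEmpty _ (proj₁ (leader-at i)) , component-minimal _)

  -- The listed components are non-empty passages covering E, and two of
  -- them sharing an edge have linked, hence equal, leaders.
  partitions : IsPassagePartitioning E components
  partitions = (λ i → component-passage _ , component-nonEmpty _ (proj₁ (leader-at i)))
             , (λ x y e → let (i , r~x) = edge-position x y e in i , ∧-intro e r~x)
             , λ i j i≢j x y (in-i , in-j) → i≢j (lookup-injective leaders-unique i j
                 (leader-unique _ _ (leader-at i) (leader-at j)
                   (linked-trans _ x _ (∧-elimʳ in-i) (linked-sym _ x (∧-elimʳ in-j)))))
    where
    leaders-unique : Unique leaders
    leaders-unique = filter⁺ isLeader? (allFin⁺ n)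

mainTheorem6 : (n : ℕ) (E : Graph n) →
    Σ[ m ∈ ℕ ] Σ[ 𝒫 ∈ (Fin m → EdgeSet n) ]
    (Enumerates E 𝒫 × IsPassagePartitioning E 𝒫)
mainTheorem6 n E = length leaders , components , enumerates , partitions
  where open Components E
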